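{- Let $f(t)$ be a delta series with complex coefficients, i.e. $f(0)=0$ and $f'(0)\neq 0$, and let $\bar f(t)$ be its compositional inverse. For all integers $n\ge k\ge 0$, \[ S_{1}(n,k; f(t))=\binom{n-1}{k-1}B_{n-k,\bar{f}(t)}^{(n)} =B_{n,k}\big(S_{1}(1,1; f(t)),\,S_{1}(2,1; f(t)),\,\dots,\,S_{1}(n-k+1,1; f(t))\big) =B_{n,k}\Big(B_{0,\bar{f}(t)}^{(1)},\,B_{1,\bar{f}(t)}^{(2)},\,\dots,\,B_{n-k,\bar{f}(t)}^{(n-k+1)}\Big). \]
   Context: All series are formal power series in $t$ over $\mathbb{C}$. A delta series is a formal power series $g(t)$ with $g(0)=0$, $g'(0)\neq0$; it has a compositional inverse $\bar g(t)$, also a delta series, with $g(\bar g(t))=t=\bar g(g(t))$. For a delta series $g(t)$ and an integer $m\ge 0$, the Bernoulli polynomials of order $m$ associated with $g$ are defined by $\big(\frac{t}{e^{g(t)}-1}\big)^{m}e^{xg(t)}=\sum_{n\ge0}B_{n,g(t)}^{(m)}(x)\frac{t^n}{n!}$, and $B_{n,g(t)}^{(m)}=B_{n,g(t)}^{(m)}(0)$; here it is applied with $g=\bar f$. Let $e_{f(t)}(t)=e^{\bar f(t)}-1$ (a delta series) and let $\bar e_{f(t)}(t)$ be its compositional inverse (which equals $f(\log(1+t))$). The Stirling numbers of the first kind associated with $f$ are defined by $\frac{1}{k!}\big(\bar e_{f(t)}(t)\big)^{k}=\sum_{n\ge k}S_1(n,k;f(t))\frac{t^n}{n!}$ for $k\ge0$.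 The partial Bell polynomials $B_{n,k}$ are defined by $\frac{1}{k!}\big(\sum_{m\ge1}x_m\frac{t^m}{m!}\big)^k=\sum_{n\ge k}B_{n,k}(x_1,\dots,x_{n-k+1})\frac{t^n}{n!}$. Binomial coefficients $\binom{a}{b}$ with integer $b<0$ are $0$, except that $\binom{ -1}{ -1}$ is taken to be $1$ (relevant only for $n=k=0$). -}

module Defs where

open import Level using (_⊔_) renaming (suc to lsuc)
open import Data.Nat using (ℕ; zero; suc; _∸_; _≤_; _≤ᵇ_)
open import Data.Nat using (_!)
open import Data.Nat.Combinatorics using (_C_)
open import Data.Bool using (if_then_else_)
open import Data.Product using (Σ; _×_)
open import Relation.Nullary using (¬_)
open import Algebra.Bundles using (CommutativeRing)

-- A field of characteristic zero (stand-in for ℂ), given as a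
-- commutative ring with 1 ≉ 0, multiplicative inverses of nonzero elements,
-- and nonvanishing of the images of all positive naturals.
-- image of a natural number in a ring: natR n = 1 + 1 + ... + 1
natR : ∀ {c ℓ} (R : CommutativeRing c ℓ) → ℕ → CommutativeRing.Carrier R
natR R zero    = CommutativeRing.0# R
natR R (suc n) = CommutativeRing._+_ R (CommutativeRing.1# R) (natR R n)

record CharZeroField (c ℓ : Level.Level) : Set (lsuc (c ⊔ ℓ)) where
  field
    cring : CommutativeRing c ℓ
  open CommutativeRing cring public
  field
    1≉0     : ¬ (1# ≈ 0#)
    inverse : ∀ x → ¬ (x ≈ 0#) → Σ Carrier (λ y → x * y ≈ 1#)
    charZero : ∀ n → ¬ (natR cring (suc n) ≈ 0#)

module Series {c ℓ} (F : CharZeroField c ℓ) where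
  open CharZeroField F public

  natF : ℕ → Carrier
  natF = natR cring

  PS : Set c
  PS = ℕ → Carrier

  _≈ₛ_ : PS → PS → Set ℓ
  a ≈ₛ b = ∀ n → a n ≈ b n

  invSuc : ℕ → Carrier
  invSuc n = Data.Product.proj₁ (inverse (natF (suc n)) (charZero n))

  invFact : ℕ → Carrier
  invFact zero    = 1#
  invFact (suc k) = invSuc k * invFact k

  sumTo : ℕ → (ℕ → Carrier) → Carrier
  sumTo zero    g = g 0
  sumTo (suc n) g = sumTo n g + g (suc n)

  oneS : PS
  oneS zero    = 1#
  oneS (suc _) = 0#

  tS : PS
  tS 1 = 1#
  tS _ = 0#

  mulS : PS → PS → PS
  mulS a b n = sumTo n (λ i → a i * b (n ∸ i))

  powS : PS → ℕ → PS
  powS a zero    = oneS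
  powS a (suc k) = mulS a (powS a k)

  -- composition g(h(t)); meaningful (and used only) when h(0) = 0, in which
  -- case the coefficient of t^n only involves g_0 .. g_n.
  compS : PS → PS → PS
  compS g h n = sumTo n (λ k → g k * powS h k n)

  IsDelta : PS → Set ℓ
  IsDelta g = (g 0 ≈ 0#) × (¬ (g 1 ≈ 0#))

  IsCompInverse : PS → PS → Set ℓ
  IsCompInverse g gbar = (gbar 0 ≈ 0#) × (compS g gbar ≈ₛ tS) × (compS gbar g ≈ₛ tS)

  expm1 : PS
  expm1 zero    = 0#
  expm1 (suc k) = invFact (suc k)

  eOf : PS → PS
  eOf fbar = compS expm1 fbar

  IsTOverExpm1 : PS → PS → Set ℓ
  IsTOverExpm1 g q = mulS q (compS expm1 g) ≈ₛ tS

  -- Bernoulli numbers of order m associated with g, given q = t/(e^{g}-1):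
  -- (t/(e^{g}-1))^m = Σ B^{(m)}_{n,g} t^n/n!
  bernoulli : (q : PS) → (m n : ℕ) → Carrier
  bernoulli q m n = natF (n !) * powS q m n

  -- Stirling numbers of the first kind associated with f, given ebar (the
  -- compositional inverse of e_f): (1/k!) ebar^k = Σ S1(n,k;f) t^n/n!
  stirling1 : (ebar : PS) → (n k : ℕ) → Carrier
  stirling1 ebar n k = natF (n !) * (invFact k * powS ebar k n)

  -- partial Bell polynomial B_{n,k}(x_1,...,x_{n-k+1}); x m is x_m (m ≥ 1),
  -- only x_1 .. x_{n-k+1} are consulted.
  bell : (n k : ℕ) → (x : ℕ → Carrier) → Carrier
  bell n k x = natF (n !) * (invFact k * powS X k n)
    where
      X : PS
      X zero    = 0#
      X (suc m) = if suc m ≤ᵇ suc (n ∸ k) then x (suc m) * invFact (suc m) else 0#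

  -- binomial coefficient (n-1 choose k-1) with the paper's conventions:
  -- 0 for k-1 < 0, except (-1 choose -1) = 1.
  binomNK : ℕ → ℕ → Carrier
  binomNK zero    zero    = 1#
  binomNK (suc _) zero    = 0#
  binomNK n       (suc k) = natF ((n ∸ 1) C k)

-- Write h = e^{fbar} - 1, so that ebar is the compositional inverse of h and
-- q = t/h.  Lagrange inversion gives n [t^n] ebar^k = k [t^{n-k}] q^n, and
-- clearing factorials this is S1(n,k) = C(n-1,k-1) B^{(n)}_{n-k}.  Lagrange
-- inversion itself comes from differentiating Σ_j [ebar^k]_j h^j = t^k,
-- multiplying by q^n and comparing coefficients of t^{n-1}: the left side
-- collapses because [t^r] q^{r+1} h' = δ_{r0}, a consequence of (q h)' = 1.
-- The Bell forms follow since B_{n,k}(x) = (n!/k!) [t^n] X^k with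
-- X = Σ_m x_m t^m/m!; for x_m = S1(m,1) = B^{(m)}_{m-1} (the case k = 1 of
-- the first identity) X agrees with ebar in every coefficient that matters.
module Submission where

open import Defs
open import Data.Nat as ℕ using (ℕ; zero; suc; _∸_; _≤_; _<_; z≤n; s≤s; _!)
import Data.Nat.Properties as ℕP
open import Data.Nat.Combinatorics using (_C_; nCk≡n!/k![n-k]!; k![n∸k]!∣n!)
open import Data.Nat.DivMod using (m/n*n≡m)
open import Data.Sum using (inj₁; inj₂)
open import Data.Product using (_×_; _,_; proj₁; proj₂)
open import Data.Bool using (T; true; if_then_else_)
open import Data.Empty using (⊥-elim)
open import Function using (_∘_)
open import Relation.Nullary using (yes; no)
open import Relation.Binary.PropositionalEquality as P using (_≡_; _≢_)
open import Algebra.Bundles using (CommutativeMonoid)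
import Algebra.Properties.CommutativeSemigroup as CommSemigroupProperties

module FormalSeries {c ℓ} (F : CharZeroField c ℓ) where
  open Series F hiding (zero)
  open import Relation.Binary.Reasoning.Setoid setoid
  open import Algebra.Properties.Group +-group using (identityʳ-unique)
  open CommSemigroupProperties *-commutativeSemigroup using (interchange; x∙yz≈y∙xz)
  open CommSemigroupProperties +-commutativeSemigroup using () renaming (interchange to +-interchange)

  sumTo-cong : ∀ n {f g} → (∀ i → i ≤ n → f i ≈ g i) → sumTo n f ≈ sumTo n g
  sumTo-cong zero    f≈g = f≈g 0 z≤n
  sumTo-cong (suc n) f≈g =
    +-cong (sumTo-cong n (λ i i≤n → f≈g i (ℕP.m≤n⇒m≤1+n i≤n))) (f≈g (suc n) ℕP.≤-refl)

  sumTo-distrib-+ : ∀ n f g → sumTo n (λ i → f i + g i) ≈ sumTo n f + sumTo n g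
  sumTo-distrib-+ zero    f g = refl
  sumTo-distrib-+ (suc n) f g = trans (+-congʳ (sumTo-distrib-+ n f g)) (+-interchange _ _ _ _)

  *-distribˡ-sumTo : ∀ n x f → x * sumTo n f ≈ sumTo n (λ i → x * f i)
  *-distribˡ-sumTo zero    x f = refl
  *-distribˡ-sumTo (suc n) x f = trans (distribˡ x _ _) (+-congʳ (*-distribˡ-sumTo n x f))

  *-distribʳ-sumTo : ∀ n x f → sumTo n f * x ≈ sumTo n (λ i → f i * x)
  *-distribʳ-sumTo zero    x f = refl
  *-distribʳ-sumTo (suc n) x f = trans (distribʳ x _ _) (+-congʳ (*-distribʳ-sumTo n x f))

  sumTo-zero : ∀ n {f} → (∀ i → i ≤ n → f i ≈ 0#) → sumTo n f ≈ 0#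
  sumTo-zero zero    f≈0 = f≈0 0 z≤n
  sumTo-zero (suc n) f≈0 =
    trans (+-cong (sumTo-zero n (λ i i≤n → f≈0 i (ℕP.m≤n⇒m≤1+n i≤n))) (f≈0 (suc n) ℕP.≤-refl))
          (+-identityʳ 0#)

  sumTo-single : ∀ n j {f} → j ≤ n → (∀ i → i ≤ n → i ≢ j → f i ≈ 0#) → sumTo n f ≈ f j
  sumTo-single zero .zero z≤n others = refl
  sumTo-single (suc n) j j≤1+n others with j ℕ.≟ suc n
  ... | yes P.refl = trans (+-congʳ (sumTo-zero n (λ i i≤n →
                       others i (ℕP.m≤n⇒m≤1+n i≤n) (ℕP.<⇒≢ (s≤s i≤n))))) (+-identityˡ _)
  ... | no j≢1+n = trans (+-cong (sumTo-single n j (ℕP.≤-pred (ℕP.≤∧≢⇒< j≤1+n j≢1+n))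
                                   (λ i i≤n → others i (ℕP.m≤n⇒m≤1+n i≤n)))
                                 (others (suc n) ℕP.≤-refl (j≢1+n ∘ P.sym)))
                         (+-identityʳ _)

  sumTo-vanishing-tail : ∀ n m {f} → m ≤ n → (∀ i → m < i → i ≤ n → f i ≈ 0#) → sumTo n f ≈ sumTo m f
  sumTo-vanishing-tail zero .zero z≤n tail = refl
  sumTo-vanishing-tail (suc n) m m≤1+n tail with ℕP.m≤n⇒m<n∨m≡n m≤1+n
  ... | inj₂ P.refl = refl
  ... | inj₁ m<1+n  =
    trans (+-cong (sumTo-vanishing-tail n m (ℕP.≤-pred m<1+n)
                     (λ i m<i i≤n → tail i m<i (ℕP.m≤n⇒m≤1+n i≤n)))
                  (tail (suc n) m<1+n ℕP.≤-refl))
          (+-identityʳ _)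

  sumTo-head : ∀ n f → sumTo (suc n) f ≈ f 0 + sumTo n (λ i → f (suc i))
  sumTo-head zero    f = refl
  sumTo-head (suc n) f = trans (+-congʳ (sumTo-head n f)) (+-assoc _ _ _)

  sumTo-reverse : ∀ n f → sumTo n f ≈ sumTo n (λ i → f (n ∸ i))
  sumTo-reverse zero    f = refl
  sumTo-reverse (suc n) f = begin
    sumTo (suc n) f                          ≈⟨ sumTo-head n f ⟩
    f 0 + sumTo n (λ i → f (suc i))          ≈⟨ +-congˡ (sumTo-reverse n (λ i → f (suc i))) ⟩
    f 0 + sumTo n (λ i → f (suc (n ∸ i)))    ≈⟨ +-comm _ _ ⟩
    sumTo n (λ i → f (suc (n ∸ i))) + f 0    ≈⟨ +-cong (sumTo-cong n (λ i i≤n →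
                                                  reflexive (P.cong f (P.sym (ℕP.+-∸-assoc 1 i≤n)))))
                                                (reflexive (P.cong f (P.sym (ℕP.n∸n≡0 n)))) ⟩
    sumTo (suc n) (λ i → f (suc n ∸ i))      ∎

  sumTo-swap : ∀ n m (f : ℕ → ℕ → Carrier) →
               sumTo n (λ i → sumTo m (f i)) ≈ sumTo m (λ j → sumTo n (λ i → f i j))
  sumTo-swap zero    m f = refl
  sumTo-swap (suc n) m f = trans (+-congʳ (sumTo-swap n m f)) (sym (sumTo-distrib-+ m _ _))

  sumTo-triangle : ∀ n (f : ℕ → ℕ → Carrier) →
                   sumTo n (λ i → sumTo i (f i)) ≈ sumTo n (λ j → sumTo (n ∸ j) (λ l → f (j ℕ.+ l) j))
  sumTo-triangle zero    f = refl
  sumTo-triangle (suc n) f = begin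
    sumTo n (λ i → sumTo i (f i)) + (sumTo n (f (suc n)) + f (suc n) (suc n))
      ≈⟨ +-congʳ (sumTo-triangle n f) ⟩
    sumTo n column + (sumTo n (f (suc n)) + f (suc n) (suc n))
      ≈⟨ sym (+-assoc _ _ _) ⟩
    (sumTo n column + sumTo n (f (suc n))) + f (suc n) (suc n)
      ≈⟨ +-cong (trans (sym (sumTo-distrib-+ n _ _)) (sumTo-cong n extend-column)) last-column ⟩
    sumTo (suc n) (λ j → sumTo (suc n ∸ j) (λ l → f (j ℕ.+ l) j)) ∎
    where
    column : ℕ → Carrier
    column j = sumTo (n ∸ j) (λ l → f (j ℕ.+ l) j)
    extend-column : ∀ j → j ≤ n → column j + f (suc n) j ≈ sumTo (suc n ∸ j) (λ l → f (j ℕ.+ l) j)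
    extend-column j j≤n rewrite ℕP.+-∸-assoc 1 j≤n =
      +-congˡ (reflexive (P.cong (λ i → f i j)
        (P.sym (P.trans (ℕP.+-suc j (n ∸ j)) (P.cong suc (ℕP.m+[n∸m]≡n j≤n))))))
    last-column : f (suc n) (suc n) ≈ sumTo (n ∸ n) (λ l → f (suc n ℕ.+ l) (suc n))
    last-column rewrite ℕP.n∸n≡0 n = reflexive (P.cong (λ i → f i (suc n)) (P.sym (ℕP.+-identityʳ (suc n))))

  addS : PS → PS → PS
  addS a b m = a m + b m

  scaleS : Carrier → PS → PS
  scaleS x a m = x * a m

  mulS-cong-≤ : ∀ n {a a' b b'} → (∀ i → i ≤ n → a i ≈ a' i) → (∀ i → i ≤ n → b i ≈ b' i) →
                mulS a b n ≈ mulS a' b' n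
  mulS-cong-≤ n a≈a' b≈b' = sumTo-cong n (λ i i≤n → *-cong (a≈a' i i≤n) (b≈b' (n ∸ i) (ℕP.m∸n≤m n i)))

  mulS-cong : ∀ {a a' b b'} → a ≈ₛ a' → b ≈ₛ b' → mulS a b ≈ₛ mulS a' b'
  mulS-cong a≈a' b≈b' n = mulS-cong-≤ n (λ i _ → a≈a' i) (λ i _ → b≈b' i)

  mulS-comm : ∀ a b → mulS a b ≈ₛ mulS b a
  mulS-comm a b n = trans (sumTo-reverse n (λ i → a i * b (n ∸ i)))
    (sumTo-cong n (λ i i≤n → trans (*-comm _ _) (*-congʳ (reflexive (P.cong b (ℕP.m∸[m∸n]≡n i≤n))))))

  mulS-assoc : ∀ a b d → mulS (mulS a b) d ≈ₛ mulS a (mulS b d)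
  mulS-assoc a b d n = begin
    sumTo n (λ i → sumTo i (λ j → a j * b (i ∸ j)) * d (n ∸ i))
      ≈⟨ sumTo-cong n (λ i _ → *-distribʳ-sumTo i _ _) ⟩
    sumTo n (λ i → sumTo i (λ j → a j * b (i ∸ j) * d (n ∸ i)))
      ≈⟨ sumTo-triangle n (λ i j → a j * b (i ∸ j) * d (n ∸ i)) ⟩
    sumTo n (λ j → sumTo (n ∸ j) (λ l → a j * b (j ℕ.+ l ∸ j) * d (n ∸ (j ℕ.+ l))))
      ≈⟨ sumTo-cong n (λ j _ → trans (sumTo-cong (n ∸ j) (λ l _ → reindex j l)) (sym (*-distribˡ-sumTo (n ∸ j) _ _))) ⟩
    sumTo n (λ j → a j * sumTo (n ∸ j) (λ l → b l * d (n ∸ j ∸ l))) ∎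
    where
    reindex : ∀ j l → a j * b (j ℕ.+ l ∸ j) * d (n ∸ (j ℕ.+ l)) ≈ a j * (b l * d (n ∸ j ∸ l))
    reindex j l = trans (*-assoc _ _ _) (*-congˡ (*-cong (reflexive (P.cong b (ℕP.m+n∸m≡n j l)))
                                                         (reflexive (P.cong d (P.sym (ℕP.∸-+-assoc n j l))))))

  mulS-distribˡ : ∀ a b d → mulS a (addS b d) ≈ₛ addS (mulS a b) (mulS a d)
  mulS-distribˡ a b d n = trans (sumTo-cong n (λ i _ → distribˡ _ _ _)) (sumTo-distrib-+ n _ _)

  mulS-identityˡ : ∀ a → mulS oneS a ≈ₛ a
  mulS-identityˡ a n = trans (sumTo-single n 0 z≤n others) (*-identityˡ _)
    where
    others : ∀ i → i ≤ n → i ≢ 0 → oneS i * a (n ∸ i) ≈ 0#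
    others zero    _ i≢0 = ⊥-elim (i≢0 P.refl)
    others (suc i) _ _   = zeroˡ _

  mulS-identityʳ : ∀ a → mulS a oneS ≈ₛ a
  mulS-identityʳ a n = trans (mulS-comm a oneS n) (mulS-identityˡ a n)

  mulS-scaleʳ : ∀ x a b → mulS a (scaleS x b) ≈ₛ scaleS x (mulS a b)
  mulS-scaleʳ x a b n = trans (sumTo-cong n (λ i _ → x∙yz≈y∙xz _ _ _)) (sym (*-distribˡ-sumTo n x _))

  mulS-t-suc : ∀ a m → mulS tS a (suc m) ≈ a m
  mulS-t-suc a m = trans (sumTo-single (suc m) 1 (s≤s z≤n) others) (*-identityˡ _)
    where
    others : ∀ i → i ≤ suc m → i ≢ 1 → tS i * a (suc m ∸ i) ≈ 0#
    others zero          _ _   = zeroˡ _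
    others (suc zero)    _ i≢1 = ⊥-elim (i≢1 P.refl)
    others (suc (suc i)) _ _   = zeroˡ _

  PS-commutativeMonoid : CommutativeMonoid c ℓ
  PS-commutativeMonoid = record
    { Carrier = PS ; _≈_ = _≈ₛ_ ; _∙_ = mulS ; ε = oneS
    ; isCommutativeMonoid = record
      { isMonoid = record
        { isSemigroup = record
          { isMagma = record
            { isEquivalence = record
              { refl = λ _ → refl ; sym = λ p n → sym (p n) ; trans = λ p q n → trans (p n) (q n) }
            ; ∙-cong = mulS-cong }
          ; assoc = mulS-assoc }
        ; identity = mulS-identityˡ , mulS-identityʳ }
      ; comm = mulS-comm } }

  open CommutativeMonoid PS-commutativeMonoid using ()
    renaming (refl to ≈ₛ-refl; sym to ≈ₛ-sym; trans to ≈ₛ-trans; reflexive to ≈ₛ-reflexive)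
  module PS = CommSemigroupProperties (CommutativeMonoid.commutativeSemigroup PS-commutativeMonoid)

  powS-cong : ∀ {a b} k → a ≈ₛ b → powS a k ≈ₛ powS b k
  powS-cong zero    a≈b = ≈ₛ-refl
  powS-cong (suc k) a≈b = mulS-cong a≈b (powS-cong k a≈b)

  powS-+ : ∀ a m n → powS a (m ℕ.+ n) ≈ₛ mulS (powS a m) (powS a n)
  powS-+ a zero    n = ≈ₛ-sym (mulS-identityˡ _)
  powS-+ a (suc m) n = ≈ₛ-trans (mulS-cong (≈ₛ-refl {a}) (powS-+ a m n)) (≈ₛ-sym (mulS-assoc a (powS a m) (powS a n)))

  powS-mulS : ∀ a b n → powS (mulS a b) n ≈ₛ mulS (powS a n) (powS b n)
  powS-mulS a b zero    = ≈ₛ-sym (mulS-identityˡ _)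
  powS-mulS a b (suc n) = ≈ₛ-trans (mulS-cong (≈ₛ-refl {mulS a b}) (powS-mulS a b n)) (PS.interchange a b (powS a n) (powS b n))

  powS-vanishes-below : ∀ a → a 0 ≈ 0# → ∀ j m → m < j → powS a j m ≈ 0#
  powS-vanishes-below a a0≈0 (suc j) m m<1+j = sumTo-zero m (term m m<1+j)
    where
    term : ∀ m → m < suc j → ∀ i → i ≤ m → a i * powS a j (m ∸ i) ≈ 0#
    term m _ zero _ = trans (*-congʳ a0≈0) (zeroˡ _)
    term (suc m) (s≤s m<j) (suc i) (s≤s i≤m) =
      trans (*-congˡ (powS-vanishes-below a a0≈0 j (m ∸ i) (ℕP.≤-<-trans (ℕP.m∸n≤m m i) m<j))) (zeroʳ _)

  mulS-powS-t : ∀ a j m → j ≤ m → mulS a (powS tS j) m ≈ a (m ∸ j)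
  mulS-powS-t a zero    m       _         = mulS-identityʳ a m
  mulS-powS-t a (suc j) (suc m) (s≤s j≤m) =
    trans (PS.x∙yz≈y∙xz a tS (powS tS j) (suc m)) (trans (mulS-t-suc (mulS a (powS tS j)) m) (mulS-powS-t a j m j≤m))

  powS-agree : ∀ a b L → a 0 ≈ 0# → b 0 ≈ 0# → (∀ i → suc i ≤ L → a (suc i) ≈ b (suc i)) →
               ∀ k m → m < L ℕ.+ k → powS a k m ≈ powS b k m
  powS-agree a b L a0≈0 b0≈0 a≈b zero    m _     = refl
  powS-agree a b L a0≈0 b0≈0 a≈b (suc k) m m<L+1+k = sumTo-cong m (term m m<L+1+k)
    where
    shrink : ∀ {m} → suc m < L ℕ.+ suc k → m < L ℕ.+ k
    shrink {m} 1+m<L+1+k = ℕP.≤-pred (P.subst (suc (suc m) ≤_) (ℕP.+-suc L k) 1+m<L+1+k)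
    term : ∀ m → m < L ℕ.+ suc k → ∀ i → i ≤ m → a i * powS a k (m ∸ i) ≈ b i * powS b k (m ∸ i)
    term m _ zero _ = trans (trans (*-congʳ a0≈0) (zeroˡ _)) (sym (trans (*-congʳ b0≈0) (zeroˡ _)))
    term (suc m) 1+m<L+1+k (suc i) (s≤s i≤m) with suc i ℕ.≤? L
    ... | yes 1+i≤L = *-cong (a≈b i 1+i≤L)
                             (powS-agree a b L a0≈0 b0≈0 a≈b k (m ∸ i) (ℕP.≤-<-trans (ℕP.m∸n≤m m i) (shrink 1+m<L+1+k)))
    ... | no 1+i≰L = trans (trans (*-congˡ (low a a0≈0)) (zeroʳ _)) (sym (trans (*-congˡ (low b b0≈0)) (zeroʳ _)))
      where
      m∸i<k : m ∸ i < k
      m∸i<k = P.subst (m ∸ i <_) (ℕP.m+n∸m≡n i k)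
                (ℕP.∸-monoˡ-< (ℕP.≤-trans (shrink 1+m<L+1+k) (ℕP.+-monoˡ-≤ k (ℕP.≤-pred (ℕP.≰⇒> 1+i≰L)))) i≤m)
      low : ∀ z → z 0 ≈ 0# → powS z k (m ∸ i) ≈ 0#
      low z z0≈0 = powS-vanishes-below z z0≈0 k (m ∸ i) m∸i<k

  -- Composition with a series h of order ≥ 1

  compS≤ : ℕ → PS → PS → PS
  compS≤ N a h m = sumTo N (λ j → a j * powS h j m)

  compS-oneS : ∀ h → compS oneS h ≈ₛ oneS
  compS-oneS h n = trans (sumTo-single n 0 z≤n others) (*-identityˡ _)
    where
    others : ∀ i → i ≤ n → i ≢ 0 → oneS i * powS h i n ≈ 0#
    others zero    _ i≢0 = ⊥-elim (i≢0 P.refl)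
    others (suc i) _ _   = zeroˡ _

  module _ (h : PS) (h0≈0 : h 0 ≈ 0#) where

    compS≤-compS : ∀ a {m N} → m ≤ N → compS≤ N a h m ≈ compS a h m
    compS≤-compS a {m} {N} m≤N = sumTo-vanishing-tail N m m≤N (λ j m<j _ →
      trans (*-congˡ (powS-vanishes-below h h0≈0 j m m<j)) (zeroʳ _))

    compS-mulS-expand : ∀ a b n →
      compS (mulS a b) h n ≈ sumTo n (λ i → sumTo n (λ l → a i * b l * powS h (i ℕ.+ l) n))
    compS-mulS-expand a b n = begin
      sumTo n (λ j → sumTo j (λ i → a i * b (j ∸ i)) * powS h j n)
        ≈⟨ sumTo-cong n (λ j _ → *-distribʳ-sumTo j _ _) ⟩
      sumTo n (λ j → sumTo j (λ i → a i * b (j ∸ i) * powS h j n))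
        ≈⟨ sumTo-triangle n (λ j i → a i * b (j ∸ i) * powS h j n) ⟩
      sumTo n (λ i → sumTo (n ∸ i) (λ l → a i * b (i ℕ.+ l ∸ i) * powS h (i ℕ.+ l) n))
        ≈⟨ sumTo-cong n (λ i _ → sumTo-cong (n ∸ i) (λ l _ →
             *-congʳ (*-congˡ (reflexive (P.cong b (ℕP.m+n∸m≡n i l)))))) ⟩
      sumTo n (λ i → sumTo (n ∸ i) (λ l → a i * b l * powS h (i ℕ.+ l) n))
        ≈⟨ sumTo-cong n (λ i _ → sym (sumTo-vanishing-tail n (n ∸ i) (ℕP.m∸n≤m n i) (λ l n∸i<l _ →
             trans (*-congˡ (powS-vanishes-below h h0≈0 (i ℕ.+ l) n (beyond i l n∸i<l))) (zeroʳ _)))) ⟩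
      sumTo n (λ i → sumTo n (λ l → a i * b l * powS h (i ℕ.+ l) n)) ∎
      where
      beyond : ∀ i l → n ∸ i < l → n < i ℕ.+ l
      beyond i l n∸i<l = ℕP.≤-<-trans (ℕP.m≤n+m∸n n i) (ℕP.+-monoʳ-< i n∸i<l)

    mulS-compS-expand : ∀ a b n →
      mulS (compS a h) (compS b h) n ≈ sumTo n (λ i → sumTo n (λ l → a i * b l * powS h (i ℕ.+ l) n))
    mulS-compS-expand a b n = begin
      sumTo n (λ m → compS a h m * compS b h (n ∸ m))
        ≈⟨ sumTo-cong n (λ m m≤n → *-cong (sym (compS≤-compS a m≤n)) (sym (compS≤-compS b (ℕP.m∸n≤m n m)))) ⟩
      sumTo n (λ m → compS≤ n a h m * compS≤ n b h (n ∸ m))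
        ≈⟨ sumTo-cong n (λ m _ → trans (*-distribʳ-sumTo n _ _) (sumTo-cong n (λ i _ → *-distribˡ-sumTo n _ _))) ⟩
      sumTo n (λ m → sumTo n (λ i → sumTo n (λ l → a i * powS h i m * (b l * powS h l (n ∸ m)))))
        ≈⟨ trans (sumTo-swap n n _) (sumTo-cong n (λ i _ → sumTo-swap n n _)) ⟩
      sumTo n (λ i → sumTo n (λ l → sumTo n (λ m → a i * powS h i m * (b l * powS h l (n ∸ m)))))
        ≈⟨ sumTo-cong n (λ i _ → sumTo-cong n (λ l _ → trans (sumTo-cong n (λ m _ → interchange _ _ _ _))
                                                              (sym (*-distribˡ-sumTo n _ _)))) ⟩
      sumTo n (λ i → sumTo n (λ l → a i * b l * mulS (powS h i) (powS h l) n))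
        ≈⟨ sumTo-cong n (λ i _ → sumTo-cong n (λ l _ → *-congˡ (sym (powS-+ h i l n)))) ⟩
      sumTo n (λ i → sumTo n (λ l → a i * b l * powS h (i ℕ.+ l) n)) ∎

    compS-mulS : ∀ a b → compS (mulS a b) h ≈ₛ mulS (compS a h) (compS b h)
    compS-mulS a b n = trans (compS-mulS-expand a b n) (sym (mulS-compS-expand a b n))

    compS-powS : ∀ a k → compS (powS a k) h ≈ₛ powS (compS a h) k
    compS-powS a zero    = compS-oneS h
    compS-powS a (suc k) = ≈ₛ-trans (compS-mulS a (powS a k)) (mulS-cong (≈ₛ-refl {compS a h}) (compS-powS a k))

  natF-+ : ∀ x y → natF (x ℕ.+ y) ≈ natF x + natF y
  natF-+ zero    y = sym (+-identityˡ _)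
  natF-+ (suc x) y = trans (+-congˡ (natF-+ x y)) (sym (+-assoc _ _ _))

  natF-1 : natF 1 ≈ 1#
  natF-1 = +-identityʳ _

  natF-* : ∀ x y → natF (x ℕ.* y) ≈ natF x * natF y
  natF-* zero    y = sym (zeroˡ _)
  natF-* (suc x) y = trans (natF-+ y (x ℕ.* y))
    (trans (+-cong (sym (*-identityˡ _)) (natF-* x y)) (sym (distribʳ _ _ _)))

  natF-suc-cancel : ∀ m {y} → natF (suc m) * y ≈ 0# → y ≈ 0#
  natF-suc-cancel m {y} [1+m]y≈0 = begin
    y                              ≈⟨ sym (*-identityˡ y) ⟩
    1# * y                         ≈⟨ *-congʳ (sym (trans (*-comm _ _) (proj₂ inv))) ⟩
    proj₁ inv * natF (suc m) * y   ≈⟨ *-assoc _ _ _ ⟩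
    proj₁ inv * (natF (suc m) * y) ≈⟨ *-congˡ [1+m]y≈0 ⟩
    proj₁ inv * 0#                 ≈⟨ zeroʳ _ ⟩
    0#                             ∎
    where inv = inverse (natF (suc m)) (charZero m)

  natF-suc*invSuc : ∀ n → natF (suc n) * invSuc n ≈ 1#
  natF-suc*invSuc n = proj₂ (inverse (natF (suc n)) (charZero n))

  natF-!*invFact : ∀ k → natF (k !) * invFact k ≈ 1#
  natF-!*invFact zero    = trans (*-identityʳ _) natF-1
  natF-!*invFact (suc k) = trans (*-congʳ (natF-* (suc k) (k !)))
    (trans (interchange _ _ _ _) (trans (*-cong (natF-suc*invSuc k) (natF-!*invFact k)) (*-identityˡ _)))

  invFact-suc*natF : ∀ k → invFact (suc k) * natF (suc k) ≈ invFact k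
  invFact-suc*natF k = trans (*-congʳ (*-comm _ _))
    (trans (*-assoc _ _ _) (trans (*-congˡ (trans (*-comm _ _) (natF-suc*invSuc k))) (*-identityʳ _)))

  invFact-1 : invFact 1 ≈ 1#
  invFact-1 = trans (sym (*-identityʳ _)) (trans (*-congˡ (sym natF-1)) (invFact-suc*natF 0))

  n!*invFact≈nCk*[n∸k]! : ∀ {n k} → k ≤ n → natF (n !) * invFact k ≈ natF (n C k) * natF ((n ∸ k) !)
  n!*invFact≈nCk*[n∸k]! {n} {k} k≤n = begin
    natF (n !) * invFact k
      ≈⟨ *-congʳ (trans (reflexive (P.cong natF n!≡nCk*k!*[n∸k]!))
                        (trans (natF-* (n C k) _) (*-congˡ (natF-* (k !) ((n ∸ k) !))))) ⟩
    natF (n C k) * (natF (k !) * natF ((n ∸ k) !)) * invFact k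
      ≈⟨ *-assoc _ _ _ ⟩
    natF (n C k) * (natF (k !) * natF ((n ∸ k) !) * invFact k)
      ≈⟨ *-congˡ (trans (*-congʳ (*-comm _ _))
                   (trans (*-assoc _ _ _) (trans (*-congˡ (natF-!*invFact k)) (*-identityʳ _)))) ⟩
    natF (n C k) * natF ((n ∸ k) !) ∎
    where
    n!≡nCk*k!*[n∸k]! : n ! ≡ (n C k) ℕ.* (k ! ℕ.* (n ∸ k) !)
    n!≡nCk*k!*[n∸k]! = P.sym (P.trans (P.cong (ℕ._* (k ! ℕ.* (n ∸ k) !)) (nCk≡n!/k![n-k]! k≤n))
                                      (m/n*n≡m {{ℕP._!*_!≢0 k (n ∸ k)}} (k![n∸k]!∣n! k≤n)))

  -- The formal derivative

  D : PS → PS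
  D a m = natF (suc m) * a (suc m)

  D-cong : ∀ {a b} → a ≈ₛ b → D a ≈ₛ D b
  D-cong a≈b m = *-congˡ (a≈b (suc m))

  D-oneS : ∀ m → D oneS m ≈ 0#
  D-oneS m = zeroʳ _

  D-t : D tS ≈ₛ oneS
  D-t zero    = trans (*-identityʳ _) natF-1
  D-t (suc m) = zeroʳ _

  D-mulS : ∀ a b → D (mulS a b) ≈ₛ addS (mulS (D a) b) (mulS a (D b))
  D-mulS a b m = begin
    natF (suc m) * sumTo (suc m) (λ i → a i * b (suc m ∸ i))
      ≈⟨ *-distribˡ-sumTo (suc m) _ _ ⟩
    sumTo (suc m) (λ i → natF (suc m) * (a i * b (suc m ∸ i)))
      ≈⟨ sumTo-cong (suc m) (λ i i≤1+m → trans (*-congʳ (split i i≤1+m)) (distribʳ _ _ _)) ⟩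
    sumTo (suc m) (λ i → natF i * (a i * b (suc m ∸ i)) + natF (suc m ∸ i) * (a i * b (suc m ∸ i)))
      ≈⟨ sumTo-distrib-+ (suc m) _ _ ⟩
    sumTo (suc m) (λ i → natF i * (a i * b (suc m ∸ i))) + sumTo (suc m) (λ i → natF (suc m ∸ i) * (a i * b (suc m ∸ i)))
      ≈⟨ +-cong differentiate-a differentiate-b ⟩
    mulS (D a) b m + mulS a (D b) m ∎
    where
    split : ∀ i → i ≤ suc m → natF (suc m) ≈ natF i + natF (suc m ∸ i)
    split i i≤1+m = trans (reflexive (P.cong natF (P.sym (ℕP.m+[n∸m]≡n i≤1+m)))) (natF-+ i _)
    differentiate-a : sumTo (suc m) (λ i → natF i * (a i * b (suc m ∸ i))) ≈ mulS (D a) b m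
    differentiate-a = trans (sumTo-head m _) (trans (+-congʳ (zeroˡ _))
      (trans (+-identityˡ _) (sumTo-cong m (λ i _ → sym (*-assoc _ _ _)))))
    differentiate-b : sumTo (suc m) (λ i → natF (suc m ∸ i) * (a i * b (suc m ∸ i))) ≈ mulS a (D b) m
    differentiate-b = trans (+-congˡ (trans (*-congʳ (reflexive (P.cong natF (ℕP.n∸n≡0 m)))) (zeroˡ _)))
      (trans (+-identityʳ _) (sumTo-cong m (λ i i≤m → trans (x∙yz≈y∙xz _ _ _)
        (*-congˡ (reflexive (P.cong (λ z → natF z * b z) (ℕP.+-∸-assoc 1 i≤m)))))))

  D-powS : ∀ a j → D (powS a (suc j)) ≈ₛ scaleS (natF (suc j)) (mulS (powS a j) (D a))
  D-powS a zero m = trans (D-cong (mulS-identityʳ a) m)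
    (sym (trans (*-congʳ natF-1) (trans (*-identityˡ _) (mulS-identityˡ (D a) m))))
  D-powS a (suc j) m = begin
    D (mulS a aʲ⁺¹) m
      ≈⟨ D-mulS a aʲ⁺¹ m ⟩
    mulS (D a) aʲ⁺¹ m + mulS a (D aʲ⁺¹) m
      ≈⟨ +-cong (mulS-comm (D a) aʲ⁺¹ m) (trans (mulS-cong (≈ₛ-refl {a}) (D-powS a j) m)
           (trans (mulS-scaleʳ (natF (suc j)) a (mulS (powS a j) (D a)) m) (*-congˡ (sym (mulS-assoc a (powS a j) (D a) m))))) ⟩
    mulS aʲ⁺¹ (D a) m + natF (suc j) * mulS aʲ⁺¹ (D a) m
      ≈⟨ trans (+-congʳ (sym (*-identityˡ _))) (sym (distribʳ _ _ _)) ⟩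
    natF (suc (suc j)) * mulS aʲ⁺¹ (D a) m ∎
    where aʲ⁺¹ = powS a (suc j)

  D-compS≤ : ∀ N a h m → D (compS≤ N a h) m ≈ sumTo N (λ j → a j * D (powS h j) m)
  D-compS≤ N a h m = trans (*-distribˡ-sumTo N _ _) (sumTo-cong N (λ j _ → x∙yz≈y∙xz _ _ _))

  mulS-D-powS-t : ∀ a k' n' → k' ≤ n' → mulS a (D (powS tS (suc k'))) n' ≈ natF (suc k') * a (n' ∸ k')
  mulS-D-powS-t a k' n' k'≤n' = begin
    mulS a (D (powS tS (suc k'))) n'
      ≈⟨ mulS-cong (≈ₛ-refl {a}) (D-powS tS k') n' ⟩
    mulS a (scaleS (natF (suc k')) (mulS (powS tS k') (D tS))) n'
      ≈⟨ mulS-scaleʳ (natF (suc k')) a (mulS (powS tS k') (D tS)) n' ⟩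
    natF (suc k') * mulS a (mulS (powS tS k') (D tS)) n'
      ≈⟨ *-congˡ (mulS-cong (≈ₛ-refl {a}) (≈ₛ-trans (mulS-cong (≈ₛ-refl {powS tS k'}) D-t) (mulS-identityʳ _)) n') ⟩
    natF (suc k') * mulS a (powS tS k') n'
      ≈⟨ *-congˡ (mulS-powS-t a k' n' k'≤n') ⟩
    natF (suc k') * a (n' ∸ k') ∎

  -- Lagrange inversion

  module LagrangeInversion (g h q : PS) (h0≈0 : h 0 ≈ 0#)
                           (g∘h≈t : compS g h ≈ₛ tS) (q*h≈t : mulS q h ≈ₛ tS) where

    -- [t^{n-1}] q^n a'.  As q^{r+1} = t^{r+1}/h^{r+1}, qD r h is the residue of h'/h^{r+1}.
    qD : ℕ → PS → Carrier
    qD n' a = mulS (powS q (suc n')) (D a) n'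

    D[q*h]≈1 : addS (mulS (D q) h) (mulS q (D h)) ≈ₛ oneS
    D[q*h]≈1 = ≈ₛ-trans (≈ₛ-sym (D-mulS q h)) (≈ₛ-trans (D-cong q*h≈t) D-t)

    residue-zero : qD 0 h ≈ 1#
    residue-zero = trans (mulS-cong (mulS-identityʳ q) (≈ₛ-refl {D h}) 0)
      (trans (sym (+-identityˡ _)) (trans (+-congʳ (sym (trans (*-congˡ h0≈0) (zeroʳ _)))) (D[q*h]≈1 0)))

    residue-suc : ∀ m → qD (suc m) h ≈ 0#
    residue-suc m = natF-suc-cancel m (identityʳ-unique (natF (suc m) * A) (natF (suc m) * qD (suc m) h)
                      (trans (sym (distribˡ _ _ _)) (trans (*-congˡ A+residue≈Qₘ₊₁) (sym [1+m]A≈[1+m]Qₘ₊₁))))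
      where
      Q = powS q (suc m)
      A = mulS Q (mulS (D q) h) (suc m)
      A+residue≈Qₘ₊₁ : A + qD (suc m) h ≈ Q (suc m)
      A+residue≈Qₘ₊₁ = begin
        A + qD (suc m) h
          ≈⟨ +-congˡ (sym (trans (sym (mulS-assoc Q q (D h) (suc m))) (mulS-cong (mulS-comm Q q) (≈ₛ-refl {D h}) (suc m)))) ⟩
        A + mulS Q (mulS q (D h)) (suc m)
          ≈⟨ sym (mulS-distribˡ Q (mulS (D q) h) (mulS q (D h)) (suc m)) ⟩
        mulS Q (addS (mulS (D q) h) (mulS q (D h))) (suc m)
          ≈⟨ trans (mulS-cong (≈ₛ-refl {Q}) D[q*h]≈1 (suc m)) (mulS-identityʳ Q (suc m)) ⟩
        Q (suc m) ∎
      -- q^{m+1} q' h = t q^m q', and (m+1) q^m q' = (q^{m+1})'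
      [1+m]A≈[1+m]Qₘ₊₁ : natF (suc m) * A ≈ natF (suc m) * Q (suc m)
      [1+m]A≈[1+m]Qₘ₊₁ = trans (*-congˡ (trans (Q*q'h≈t*qᵐq' (suc m)) (mulS-t-suc (mulS (powS q m) (D q)) m))) (sym (D-powS q m m))
        where
        Q*q'h≈t*qᵐq' : mulS Q (mulS (D q) h) ≈ₛ mulS tS (mulS (powS q m) (D q))
        Q*q'h≈t*qᵐq' = ≈ₛ-trans (mulS-cong (mulS-comm q (powS q m)) (≈ₛ-refl {mulS (D q) h}))
          (≈ₛ-trans (PS.interchange (powS q m) q (D q) h)
          (≈ₛ-trans (mulS-cong (≈ₛ-refl {mulS (powS q m) (D q)}) q*h≈t) (mulS-comm _ tS)))

    qD-powS-h : ∀ n' j → j ≤ n' → qD n' (powS h (suc j)) ≈ natF (suc j) * qD (n' ∸ j) h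
    qD-powS-h n' j j≤n' = begin
      mulS Q (D (powS h (suc j))) n'
        ≈⟨ mulS-cong (≈ₛ-refl {Q}) (D-powS h j) n' ⟩
      mulS Q (scaleS (natF (suc j)) (mulS (powS h j) (D h))) n'
        ≈⟨ mulS-scaleʳ (natF (suc j)) Q (mulS (powS h j) (D h)) n' ⟩
      natF (suc j) * mulS Q (mulS (powS h j) (D h)) n'
        ≈⟨ *-congˡ (mulS-cong Q≈qʳ⁺¹*qʲ (mulS-comm (powS h j) (D h)) n') ⟩
      natF (suc j) * mulS (mulS qʳ⁺¹ (powS q j)) (mulS (D h) (powS h j)) n'
        ≈⟨ *-congˡ (PS.interchange qʳ⁺¹ (powS q j) (D h) (powS h j) n') ⟩
      natF (suc j) * mulS (mulS qʳ⁺¹ (D h)) (mulS (powS q j) (powS h j)) n'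
        ≈⟨ *-congˡ (mulS-cong (≈ₛ-refl {mulS qʳ⁺¹ (D h)}) (≈ₛ-trans (≈ₛ-sym (powS-mulS q h j)) (powS-cong j q*h≈t)) n') ⟩
      natF (suc j) * mulS (mulS qʳ⁺¹ (D h)) (powS tS j) n'
        ≈⟨ *-congˡ (mulS-powS-t _ j n' j≤n') ⟩
      natF (suc j) * qD (n' ∸ j) h ∎
      where
      Q = powS q (suc n')
      qʳ⁺¹ = powS q (suc (n' ∸ j))
      Q≈qʳ⁺¹*qʲ : Q ≈ₛ mulS qʳ⁺¹ (powS q j)
      Q≈qʳ⁺¹*qʲ = ≈ₛ-trans (≈ₛ-reflexive (P.cong (λ r → powS q (suc r)) (P.sym (ℕP.m∸n+n≡m j≤n'))))
                           (powS-+ q (suc (n' ∸ j)) j)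

    qD-compS≤ : ∀ n' a → qD n' (compS≤ (suc n') a h) ≈ natF (suc n') * a (suc n')
    qD-compS≤ n' a = begin
      mulS Q (D (compS≤ n a h)) n'
        ≈⟨ sumTo-cong n' (λ i _ → trans (*-congˡ (D-compS≤ n a h (n' ∸ i))) (*-distribˡ-sumTo n _ _)) ⟩
      sumTo n' (λ i → sumTo n (λ j → Q i * (a j * D (powS h j) (n' ∸ i))))
        ≈⟨ sumTo-swap n' n _ ⟩
      sumTo n (λ j → sumTo n' (λ i → Q i * (a j * D (powS h j) (n' ∸ i))))
        ≈⟨ sumTo-cong n (λ j _ → trans (sumTo-cong n' (λ i _ → x∙yz≈y∙xz _ _ _)) (sym (*-distribˡ-sumTo n' _ _))) ⟩
      sumTo n (λ j → a j * qD n' (powS h j))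
        ≈⟨ sumTo-single n n ℕP.≤-refl others ⟩
      a n * qD n' (powS h n)
        ≈⟨ *-congˡ (trans (qD-powS-h n' n' ℕP.≤-refl)
                          (*-congˡ (trans (reflexive (P.cong (λ r → qD r h) (ℕP.n∸n≡0 n'))) residue-zero))) ⟩
      a n * (natF n * 1#)
        ≈⟨ trans (*-comm _ _) (*-congʳ (*-identityʳ _)) ⟩
      natF n * a n ∎
      where
      n = suc n'
      Q = powS q n
      others : ∀ j → j ≤ n → j ≢ n → a j * qD n' (powS h j) ≈ 0#
      others zero _ _ = trans (*-congˡ (sumTo-zero n' (λ i _ → trans (*-congˡ (D-oneS (n' ∸ i))) (zeroʳ _)))) (zeroʳ _)
      others (suc j) (s≤s j≤n') 1+j≢n =
        trans (*-congˡ (trans (qD-powS-h n' j j≤n') (trans (*-congˡ (vanish (n' ∸ j) 0<n'∸j)) (zeroʳ _)))) (zeroʳ _)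
        where
        0<n'∸j : 0 < n' ∸ j
        0<n'∸j = ℕP.m<n⇒0<n∸m (ℕP.≤∧≢⇒< j≤n' (1+j≢n ∘ P.cong suc))
        vanish : ∀ r → 0 < r → qD r h ≈ 0#
        vanish (suc r) _ = residue-suc r

    lagrange : ∀ n' k' → k' ≤ n' → natF (suc n') * powS g (suc k') (suc n') ≈ natF (suc k') * powS q (suc n') (n' ∸ k')
    lagrange n' k' k'≤n' = begin
      natF (suc n') * powS g k (suc n')          ≈⟨ sym (qD-compS≤ n' (powS g k)) ⟩
      qD n' (compS≤ (suc n') (powS g k) h)      ≈⟨ mulS-cong-≤ n' {powS q (suc n')} (λ _ _ → refl) (λ i i≤n' → *-congˡ {natF (suc i)} (gᵏ∘h≈tᵏ (s≤s i≤n'))) ⟩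
      qD n' (powS tS k)                          ≈⟨ mulS-D-powS-t _ k' n' k'≤n' ⟩
      natF k * powS q (suc n') (n' ∸ k')         ∎
      where
      k = suc k'
      gᵏ∘h≈tᵏ : ∀ {m} → m ≤ suc n' → compS≤ (suc n') (powS g k) h m ≈ powS tS k m
      gᵏ∘h≈tᵏ {m} m≤n = trans (compS≤-compS h h0≈0 (powS g k) m≤n)
                              (trans (compS-powS h h0≈0 g k m) (powS-cong k g∘h≈t m))

  -- Stirling numbers, Bernoulli numbers and Bell polynomials

  module StirlingIdentities (fbar ebar q : PS) (ebar0≈0 : ebar 0 ≈ 0#)
                            (ebar∘e≈t : compS ebar (eOf fbar) ≈ₛ tS) (q*e≈t : IsTOverExpm1 fbar q) where
    open LagrangeInversion ebar (eOf fbar) q (zeroˡ _) ebar∘e≈t q*e≈t using (lagrange)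

    stirling1≈binomNK*bernoulli : ∀ n k → k ≤ n → stirling1 ebar n k ≈ binomNK n k * bernoulli q n (n ∸ k)
    stirling1≈binomNK*bernoulli zero    zero    _ = trans (*-congˡ (*-identityˡ _)) (sym (*-identityˡ _))
    stirling1≈binomNK*bernoulli (suc n) zero    _ = trans (trans (*-congˡ (*-identityˡ _)) (zeroʳ _)) (sym (zeroˡ _))
    stirling1≈binomNK*bernoulli (suc n') (suc k') (s≤s k'≤n') = begin
      natF (suc n' ℕ.* n' !) * (invFact (suc k') * ebarᵏₙ)
        ≈⟨ trans (*-congʳ (trans (natF-* (suc n') (n' !)) (*-comm _ _)))
                 (trans (*-assoc _ _ _) (*-congˡ (x∙yz≈y∙xz _ _ _))) ⟩
      natF (n' !) * (invFact (suc k') * (natF (suc n') * ebarᵏₙ))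
        ≈⟨ *-congˡ (*-congˡ (lagrange n' k' k'≤n')) ⟩
      natF (n' !) * (invFact (suc k') * (natF (suc k') * qⁿₙ₋ₖ))
        ≈⟨ trans (*-congˡ (trans (sym (*-assoc _ _ _)) (*-congʳ (invFact-suc*natF k')))) (sym (*-assoc _ _ _)) ⟩
      natF (n' !) * invFact k' * qⁿₙ₋ₖ
        ≈⟨ trans (*-congʳ (n!*invFact≈nCk*[n∸k]! k'≤n')) (*-assoc _ _ _) ⟩
      natF (n' C k') * (natF ((n' ∸ k') !) * qⁿₙ₋ₖ) ∎
      where
      ebarᵏₙ = powS ebar (suc k') (suc n')
      qⁿₙ₋ₖ = powS q (suc n') (n' ∸ k')

    -- B_{n,k}(x) only reads x_1 .. x_{n-k+1}, where its generating series agrees with ebar.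
    bell≈stirling1 : ∀ n k x → k ≤ n → (∀ i → x (suc i) * invFact (suc i) ≈ ebar (suc i)) →
                     bell n k x ≈ stirling1 ebar n k
    bell≈stirling1 n k x k≤n x≈ebar =
      *-congˡ (*-congˡ (powS-agree _ ebar (suc (n ∸ k)) refl ebar0≈0
        (λ i i≤L → trans (if-true (ℕP.≤⇒≤ᵇ i≤L)) (x≈ebar i)) k n
        (s≤s (ℕP.≤-reflexive (P.sym (ℕP.m∸n+n≡m k≤n))))))
      where
      if-true : ∀ {b u v} → T b → (if b then u else v) ≈ u
      if-true {true} _ = refl

    stirling1-1-coeff : ∀ i → stirling1 ebar (suc i) 1 * invFact (suc i) ≈ ebar (suc i)
    stirling1-1-coeff i = begin
      natF (suc i !) * (invFact 1 * powS ebar 1 (suc i)) * invFact (suc i)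
        ≈⟨ *-congʳ (*-congˡ (trans (*-congʳ invFact-1) (trans (*-identityˡ _) (mulS-identityʳ ebar (suc i))))) ⟩
      natF (suc i !) * ebar (suc i) * invFact (suc i)
        ≈⟨ trans (*-assoc _ _ _) (trans (*-congˡ (*-comm _ _)) (sym (*-assoc _ _ _))) ⟩
      natF (suc i !) * invFact (suc i) * ebar (suc i)
        ≈⟨ trans (*-congʳ (natF-!*invFact (suc i))) (*-identityˡ _) ⟩
      ebar (suc i) ∎

    bernoulli-coeff : ∀ i → bernoulli q (suc i) i * invFact (suc i) ≈ ebar (suc i)
    bernoulli-coeff i = trans (*-congʳ bernoulli≈stirling1) (stirling1-1-coeff i)
      where
      bernoulli≈stirling1 : bernoulli q (suc i) i ≈ stirling1 ebar (suc i) 1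
      bernoulli≈stirling1 = sym (trans (stirling1≈binomNK*bernoulli (suc i) 1 (s≤s z≤n))
                                       (trans (*-congʳ natF-1) (*-identityˡ _)))

-- Only the inverse pair (e_f, ebar) and q (e^{fbar} - 1) = t are used.
theorem2p2 : ∀ {c ℓ} (F : CharZeroField c ℓ) →
    let open Series F in
    (f fbar ebar q : PS) →
    IsDelta f → IsCompInverse f fbar →
    IsCompInverse (eOf fbar) ebar →
    IsTOverExpm1 fbar q →
    (n k : ℕ) → k ≤ n →
      (stirling1 ebar n k ≈ binomNK n k * bernoulli q n (n ∸ k))
      × (stirling1 ebar n k ≈ bell n k (λ m → stirling1 ebar m 1))
      × (stirling1 ebar n k ≈ bell n k (λ m → bernoulli q m (m ∸ 1)))
theorem2p2 F f fbar ebar q _ _ (ebar0≈0 , _ , ebar∘e≈t) q*e≈t n k k≤n =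
    stirling1≈binomNK*bernoulli n k k≤n
  , sym (bell≈stirling1 n k _ k≤n stirling1-1-coeff)
  , sym (bell≈stirling1 n k _ k≤n bernoulli-coeff)
  where
  open Series F using (sym)
  open FormalSeries.StirlingIdentities F fbar ebar q ebar0≈0 ebar∘e≈t q*e≈t
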